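{- Let $\sigma_1,\dots,\sigma_\ell\in\{0,1\}$ and suppose \[\tilde F_{\sigma_\ell}\circ\cdots\circ\tilde F_{\sigma_1}((n_1,n_2)\times[k_1,k_2])=(\bar n_1,\bar n_2)\times[\bar k_1,\bar k_2].\] Then \[\tilde F_{\sigma_1}\circ\cdots\circ\tilde F_{\sigma_\ell}\big((\bar k_1+\bar k_2,\bar k_1)\times[\bar n_2,\bar n_1-\bar n_2]\big)=(k_1+k_2,k_1)\times[n_2,n_1-n_2].\]
   Context: $(a_1,a_2)\times[c_1,c_2]$ denotes the partition with $c_1$ parts $a_1$ and $c_2$ parts $a_2$; its conjugate partition is $(c_1+c_2,c_1)\times[a_2,a_1-a_2]$. The extended Farey maps are $\tilde F_0((a_1,a_2)\times[c_1,c_2])=(a_2,a_1-a_2)\times[c_1+c_2,c_1]$ (applicable when $a_2\ge a_1-a_2$) and $\tilde F_1((a_1,a_2)\times[c_1,c_2])=(a_1-a_2,a_2)\times[c_1,c_1+c_2]$ (applicable when $a_1-a_2\ge a_2$). -}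

module Defs where

open import Data.Nat using (ℕ; _+_; _∸_; _≤?_)
open import Data.Fin using (Fin; zero; suc)
open import Data.Maybe using (Maybe; just; nothing; _>>=_)
open import Data.List using (List; []; _∷_)
open import Relation.Nullary using (yes; no)

-- (a₁ , a₂) × [ c₁ , c₂ ] : the partition with c₁ parts a₁ and c₂ parts a₂
record Part : Set where
  constructor _,_×[_,_]
  field
    a₁ a₂ c₁ c₂ : ℕ

conj : Part → Part
conj (a₁ , a₂ ×[ c₁ , c₂ ]) = (c₁ + c₂) , c₁ ×[ a₂ , a₁ ∸ a₂ ]

F̃ : Fin 2 → Part → Maybe Part
F̃ zero (a₁ , a₂ ×[ c₁ , c₂ ]) with (a₁ ∸ a₂) ≤? a₂
... | yes _ = just (a₂ , (a₁ ∸ a₂) ×[ c₁ + c₂ , c₁ ])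
... | no  _ = nothing
F̃ (suc zero) (a₁ , a₂ ×[ c₁ , c₂ ]) with a₂ ≤? (a₁ ∸ a₂)
... | yes _ = just ((a₁ ∸ a₂) , a₂ ×[ c₁ , c₁ + c₂ ])
... | no  _ = nothing

-- applyAll (σ₁ ∷ … ∷ σℓ ∷ []) p = F̃_{σℓ} ∘ ⋯ ∘ F̃_{σ₁} (p)  (σ₁ applied first),
-- defined only if each map is applicable at its step
applyAll : List (Fin 2) → Part → Maybe Part
applyAll [] p = just p
applyAll (σ ∷ σs) p = F̃ σ p >>= applyAll σs

-- Each extended Farey map intertwines with conjugation in the reverse direction:
-- if F̃_σ p = q then F̃_σ (conj q) = conj p, since conjugation swaps the roles of
-- parts and multiplicities and the applicability condition of F̃_σ at conj q is
-- automatically satisfied. Induction along the word σ₁ ⋯ σ_ℓ then reverses it.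
module Submission where

open import Defs
open import Data.Nat using (ℕ; _+_; _∸_; _≤_; _≤?_)
open import Data.Nat.Properties using (≤-irrelevant; m≤m+n; m+n∸m≡n; m+[n∸m]≡n)
open import Data.Fin using (Fin; zero; suc)
open import Data.List using (List; reverse; []; _∷_; _++_)
open import Data.List.Properties using (reverse-++)
open import Data.Maybe using (just; nothing; _>>=_)
open import Relation.Nullary using (yes; no)
open import Relation.Nullary.Decidable using (dec-yes-irr)
open import Relation.Binary.PropositionalEquality

F̃₀-applicable : ∀ {a₁ a₂} c₁ c₂ → a₁ ∸ a₂ ≤ a₂ →
  F̃ zero (a₁ , a₂ ×[ c₁ , c₂ ]) ≡ just (a₂ , (a₁ ∸ a₂) ×[ c₁ + c₂ , c₁ ])
F̃₀-applicable {a₁} {a₂} c₁ c₂ h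
  rewrite dec-yes-irr ((a₁ ∸ a₂) ≤? a₂) ≤-irrelevant h = refl

F̃₁-applicable : ∀ {a₁ a₂} c₁ c₂ → a₂ ≤ a₁ ∸ a₂ →
  F̃ (suc zero) (a₁ , a₂ ×[ c₁ , c₂ ]) ≡ just ((a₁ ∸ a₂) , a₂ ×[ c₁ , c₁ + c₂ ])
F̃₁-applicable {a₁} {a₂} c₁ c₂ h
  rewrite dec-yes-irr (a₂ ≤? (a₁ ∸ a₂)) ≤-irrelevant h = refl

F̃-conj : ∀ σ p q → F̃ σ p ≡ just q → F̃ σ (conj q) ≡ just (conj p)
F̃-conj zero (a₁ , a₂ ×[ c₁ , c₂ ]) q eq with (a₁ ∸ a₂) ≤? a₂
F̃-conj zero (a₁ , a₂ ×[ c₁ , c₂ ]) q refl | yes h = begin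
  F̃ zero ((c₁ + c₂ + c₁) , (c₁ + c₂) ×[ a₁ ∸ a₂ , a₂ ∸ (a₁ ∸ a₂) ])
    ≡⟨ F̃₀-applicable (a₁ ∸ a₂) (a₂ ∸ (a₁ ∸ a₂)) (subst (_≤ c₁ + c₂) (sym c₁-back) (m≤m+n c₁ c₂)) ⟩
  just ((c₁ + c₂) , (c₁ + c₂ + c₁ ∸ (c₁ + c₂)) ×[ a₁ ∸ a₂ + (a₂ ∸ (a₁ ∸ a₂)) , a₁ ∸ a₂ ])
    ≡⟨ cong₂ (λ x y → just ((c₁ + c₂) , x ×[ y , a₁ ∸ a₂ ])) c₁-back (m+[n∸m]≡n h) ⟩
  just ((c₁ + c₂) , c₁ ×[ a₂ , a₁ ∸ a₂ ]) ∎
  where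
  open ≡-Reasoning
  c₁-back : c₁ + c₂ + c₁ ∸ (c₁ + c₂) ≡ c₁
  c₁-back = m+n∸m≡n (c₁ + c₂) c₁
F̃-conj zero (a₁ , a₂ ×[ c₁ , c₂ ]) q () | no _
F̃-conj (suc zero) (a₁ , a₂ ×[ c₁ , c₂ ]) q eq with a₂ ≤? (a₁ ∸ a₂)
F̃-conj (suc zero) (a₁ , a₂ ×[ c₁ , c₂ ]) q refl | yes h = begin
  F̃ (suc zero) ((c₁ + (c₁ + c₂)) , c₁ ×[ a₂ , a₁ ∸ a₂ ∸ a₂ ])
    ≡⟨ F̃₁-applicable a₂ (a₁ ∸ a₂ ∸ a₂) (subst (c₁ ≤_) (sym c₁+c₂-back) (m≤m+n c₁ c₂)) ⟩
  just ((c₁ + (c₁ + c₂) ∸ c₁) , c₁ ×[ a₂ , a₂ + (a₁ ∸ a₂ ∸ a₂) ])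
    ≡⟨ cong₂ (λ x y → just (x , c₁ ×[ a₂ , y ])) c₁+c₂-back (m+[n∸m]≡n h) ⟩
  just ((c₁ + c₂) , c₁ ×[ a₂ , a₁ ∸ a₂ ]) ∎
  where
  open ≡-Reasoning
  c₁+c₂-back : c₁ + (c₁ + c₂) ∸ c₁ ≡ c₁ + c₂
  c₁+c₂-back = m+n∸m≡n c₁ (c₁ + c₂)
F̃-conj (suc zero) (a₁ , a₂ ×[ c₁ , c₂ ]) q () | no _

applyAll-++ : ∀ σs τs p → applyAll (σs ++ τs) p ≡ (applyAll σs p >>= applyAll τs)
applyAll-++ [] τs p = refl
applyAll-++ (σ ∷ σs) τs p with F̃ σ p
... | just p′ = applyAll-++ σs τs p′
... | nothing = refl

applyAll-reverse-conj : ∀ σs p q → applyAll σs p ≡ just q →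
  applyAll (reverse σs) (conj q) ≡ just (conj p)
applyAll-reverse-conj [] p q refl = refl
applyAll-reverse-conj (σ ∷ σs) p q eq with F̃ σ p in step
... | just p′ = begin
  applyAll (reverse (σ ∷ σs)) (conj q)
    ≡⟨ cong (λ τs → applyAll τs (conj q)) (reverse-++ (σ ∷ []) σs) ⟩
  applyAll (reverse σs ++ σ ∷ []) (conj q)
    ≡⟨ applyAll-++ (reverse σs) (σ ∷ []) (conj q) ⟩
  (applyAll (reverse σs) (conj q) >>= applyAll (σ ∷ []))
    ≡⟨ cong (_>>= applyAll (σ ∷ [])) (applyAll-reverse-conj σs p′ q eq) ⟩
  (F̃ σ (conj p′) >>= just)
    ≡⟨ cong (_>>= just) (F̃-conj σ p p′ step) ⟩
  just (conj p) ∎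
  where open ≡-Reasoning
applyAll-reverse-conj (σ ∷ σs) p q () | nothing

theorem4p17 : (σs : List (Fin 2)) (n₁ n₂ k₁ k₂ n̄₁ n̄₂ k̄₁ k̄₂ : ℕ) →
    applyAll σs (n₁ , n₂ ×[ k₁ , k₂ ]) ≡ just (n̄₁ , n̄₂ ×[ k̄₁ , k̄₂ ]) →
    applyAll (reverse σs) ((k̄₁ + k̄₂) , k̄₁ ×[ n̄₂ , n̄₁ ∸ n̄₂ ])
      ≡ just ((k₁ + k₂) , k₁ ×[ n₂ , n₁ ∸ n₂ ])
theorem4p17 σs n₁ n₂ k₁ k₂ n̄₁ n̄₂ k̄₁ k̄₂ =
  applyAll-reverse-conj σs (n₁ , n₂ ×[ k₁ , k₂ ]) (n̄₁ , n̄₂ ×[ k̄₁ , k̄₂ ])
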